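{- Let $\mathbf V$ be a commutative unital quantale, let $f\colon\mathbf J_1\to\mathbf J_2$ be a homomorphism of $\mathbf V$-frames $\mathbf J_1=(T_1,r_1)$, $\mathbf J_2=(T_2,r_2)$, and let $\mathbf H=(\mathbf A,F)$ be a $\mathbf V$-F-semilattice. Then there is a unique $\mathbf V$-module homomorphism $f\otimes\mathbf H\colon\mathbf J_1\otimes\mathbf H\to\mathbf J_2\otimes\mathbf H$ such that $\mathrm n(j[\mathbf J_2,\mathbf H])\circ f^{\rightarrow}=(f\otimes\mathbf H)\circ\mathrm n(j[\mathbf J_1,\mathbf H])$. Moreover, $-\otimes\mathbf H$ is a functor from $\mathbf V$-$\mathbb J$ to $\mathbf V$-$\mathbb S$.
   Context: A commutative unital quantale $\mathbf V=(V,\bigvee,\otimes,e)$: complete lattice, commutative monoid, $\otimes$ distributing over arbitrary joins. A $\mathbf V$-module $(A,\bigvee,*)$: complete lattice with $*\colon V\times A\to A$ preserving joins in each argument, $u*(v*a)=(u\otimes v)*a$, $e*a=a$; module homomorphisms preserve arbitrary joins and the action; $\mathbf V$-$\mathbb S$ is their category. A $\mathbf V$-frame is $(T,r)$ with $r\colon T\times T\to V$; a frame homomorphism $f\colon(T_1,r_1)\to(T_2,r_2)$ is a map with $r_1(i,j)\le r_2(f(i),f(j))$; $\mathbf V$-$\mathbb J$ is the category of frames. A $\mathbf V$-F-semilattice is $(\mathbf A,F)$ with $F$ a module endomorphism. $f^{\rightarrow}\colon A^{T_1}\to A^{T_2}$ is $(f^{\rightarrow}(x))(k)=\bigvee\{x(i)\mid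 f(i)=k\}$. Prenuclei on a module $\mathbf M$: $j\colon M\to M$ with $a\le j(a)$, monotone, $v*j(a)\le j(v*a)$; $M_j=\{a\mid j(a)=a\}$; $\mathrm n(j)(a)=\bigwedge\{x\in M_j\mid a\le x\}$; for a nucleus (idempotent prenucleus) $k$, $M_k$ is a module with joins $k(\bigvee S)$ and action $k(v*m)$. For $X\subseteq M\times M$, $j[X](a)=a\vee\bigvee\{c\mid\exists d\le a:(c,d)\in X\text{ or }(d,c)\in X\}$. Tensor: for a frame $\mathbf J=(T,r)$, $x\in A$, $i\in T$: $x_{ir}(j)=r(i,j)*x$, and $x_{i=}(i)=x$, $x_{i=}(j)=0$ for $j\ne i$ (elements of $A^T$). $[\mathbf J,\mathbf H]=\{(x_{ir}\vee F(x)_{i=},F(x)_{i=})\mid x\in A,i\in T\}$, $j[\mathbf J,\mathbf H]=j[[\mathbf J,\mathbf H]]$ in the pointwise module $\mathbf A^T$, $\mathbf J\otimes\mathbf H=(\mathbf A^T)_{\mathrm n(j[\mathbf J,\mathbf H])}$, with $\mathrm n(j[\mathbf J,\mathbf H])$ regarded as a map $A^T\to\mathbf J\otimes\mathbf H$. -}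

module Defs where

open import Level using (Level) renaming (suc to lsuc)
open import Data.Product using (Σ; _,_; proj₁; proj₂; _×_)
open import Data.Sum using (_⊎_; inj₁; inj₂)
open import Data.Unit.Polymorphic using (⊤; tt)
open import Data.Empty.Polymorphic using (⊥)
open import Relation.Binary.PropositionalEquality using (_≡_; refl)

-- Equality of lattice elements
-- is mutual ≤ (antisymmetry is thus built into the notion of equality).

Mutual : ∀ {ℓ} {A : Set ℓ} → (A → A → Set ℓ) → A → A → Set ℓ
Mutual _≤_ a b = (a ≤ b) × (b ≤ a)

record IsCompleteLattice {ℓ} (A : Set ℓ) (_≤_ : A → A → Set ℓ)
         (⋁ : {I : Set ℓ} → (I → A) → A) : Set (lsuc ℓ) where
  field
    ≤-refl  : ∀ {a} → a ≤ a
    ≤-trans : ∀ {a b c} → a ≤ b → b ≤ c → a ≤ c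
    ⋁-ub    : ∀ {I : Set ℓ} (x : I → A) (i : I) → x i ≤ ⋁ x
    ⋁-least : ∀ {I : Set ℓ} (x : I → A) {b : A} → (∀ i → x i ≤ b) → ⋁ x ≤ b

record Quantale ℓ : Set (lsuc ℓ) where
  infixl 7 _⊗_
  field
    V   : Set ℓ
    _≤_ : V → V → Set ℓ
    ⋁   : {I : Set ℓ} → (I → V) → V
    _⊗_ : V → V → V
    e   : V
    isCompleteLattice : IsCompleteLattice V _≤_ ⋁
    ⊗-mono      : ∀ {a a′ b b′} → a ≤ a′ → b ≤ b′ → (a ⊗ b) ≤ (a′ ⊗ b′)
    ⊗-assoc     : ∀ a b c → Mutual _≤_ ((a ⊗ b) ⊗ c) (a ⊗ (b ⊗ c))
    ⊗-comm      : ∀ a b → Mutual _≤_ (a ⊗ b) (b ⊗ a)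
    ⊗-identityˡ : ∀ a → Mutual _≤_ (e ⊗ a) a
    ⊗-distrib-⋁ : ∀ a {I : Set ℓ} (x : I → V) →
                  Mutual _≤_ (a ⊗ ⋁ x) (⋁ (λ i → a ⊗ x i))

module _ {ℓ} (Q : Quantale ℓ) where
  open Quantale Q renaming (_≤_ to _≤V_; ⋁ to ⋁V)

  record RawModule : Set (lsuc ℓ) where
    infixl 8 _*_
    field
      M   : Set ℓ
      _≤_ : M → M → Set ℓ
      ⋁   : {I : Set ℓ} → (I → M) → M
      _*_ : V → M → M

    _≈_ : M → M → Set ℓ
    _≈_ = Mutual _≤_

  record IsModule (R : RawModule) : Set (lsuc ℓ) where
    open RawModule R
    field
      isCompleteLattice : IsCompleteLattice M _≤_ ⋁
      *-mono      : ∀ {u v a b} → u ≤V v → a ≤ b → (u * a) ≤ (v * b)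
      *-distrib-⋁ : ∀ v {I : Set ℓ} (x : I → M) → (v * ⋁ x) ≈ ⋁ (λ i → v * x i)
      ⋁-distrib-* : ∀ {I : Set ℓ} (u : I → V) a → (⋁V u * a) ≈ ⋁ (λ i → u i * a)
      *-assoc     : ∀ u v a → (u * (v * a)) ≈ ((u ⊗ v) * a)
      *-identity  : ∀ a → (e * a) ≈ a

  record Module : Set (lsuc ℓ) where
    field
      raw      : RawModule
      isModule : IsModule raw
    open RawModule raw public

  record IsModHom (R S : RawModule) (h : RawModule.M R → RawModule.M S) : Set (lsuc ℓ) where
    module R = RawModule R
    module S = RawModule S
    field
      h-cong : ∀ {a b} → a R.≈ b → h a S.≈ h b
      h-⋁    : ∀ {I : Set ℓ} (x : I → R.M) → h (R.⋁ x) S.≈ S.⋁ (λ i → h (x i))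
      h-*    : ∀ v a → h (v R.* a) S.≈ (v S.* h a)

  record FSemilattice : Set (lsuc ℓ) where
    field
      A     : Module
      F     : Module.M A → Module.M A
      F-hom : IsModHom (Module.raw A) (Module.raw A) F

  record Frame : Set (lsuc ℓ) where
    field
      T : Set ℓ
      r : T → T → V

  record FrameHom (J₁ J₂ : Frame) : Set ℓ where
    open Frame
    field
      fun  : T J₁ → T J₂
      mono : ∀ i j → r J₁ i j ≤V r J₂ (fun i) (fun j)

  idFrameHom : (J : Frame) → FrameHom J J
  idFrameHom J = record { fun = λ i → i ; mono = λ i j → IsCompleteLattice.≤-refl isCompleteLattice }

  _∘F_ : {J₁ J₂ J₃ : Frame} → FrameHom J₂ J₃ → FrameHom J₁ J₂ → FrameHom J₁ J₃
  g ∘F f = record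
    { fun  = λ i → FrameHom.fun g (FrameHom.fun f i)
    ; mono = λ i j → IsCompleteLattice.≤-trans isCompleteLattice
                       (FrameHom.mono f i j) (FrameHom.mono g _ _) }

  module Constructions (R : RawModule) where
    open RawModule R

    ⊥M : M
    ⊥M = ⋁ {I = ⊥ {ℓ}} (λ ())

    _∨_ : M → M → M
    a ∨ b = ⋁ {I = ⊤ {ℓ} ⊎ ⊤ {ℓ}} (λ { (inj₁ _) → a ; (inj₂ _) → b })

    ⋀ : {I : Set ℓ} → (I → M) → M
    ⋀ {I} x = ⋁ {I = Σ M (λ y → ∀ i → y ≤ x i)} proj₁

    nucl : (M → M) → M → M
    nucl j a = ⋀ {I = Σ M (λ x → (j x ≈ x) × (a ≤ x))} proj₁

    -- j[X](a) = a ∨ ⋁ { c | ∃ d ≤ a : (c,d) ∈ X or (d,c) ∈ X },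
    -- for X ⊆ M × M given as a family indexed by K
    jgen : {K : Set ℓ} → (K → M × M) → M → M
    jgen {K} X a =
      ⋁ {I = ⊤ {ℓ} ⊎ (Σ K (λ k → proj₂ (X k) ≤ a) ⊎ Σ K (λ k → proj₁ (X k) ≤ a))}
        (λ { (inj₁ _)               → a
           ; (inj₂ (inj₁ (k , _))) → proj₁ (X k)
           ; (inj₂ (inj₂ (k , _))) → proj₂ (X k) })

  module CLProps (R : RawModule) (cl : IsCompleteLattice (RawModule.M R) (RawModule._≤_ R) (RawModule.⋁ R)) where
    open RawModule R
    open IsCompleteLattice cl
    open Constructions R

    ⋀-lb : ∀ {I : Set ℓ} (x : I → M) i → ⋀ x ≤ x i
    ⋀-lb x i = ⋁-least proj₁ (λ p → proj₂ p i)

    ⋀-glb : ∀ {I : Set ℓ} (x : I → M) {b} → (∀ i → b ≤ x i) → b ≤ ⋀ x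
    ⋀-glb x {b} h = ⋁-ub proj₁ (b , h)

    nucl-idem : ∀ j a → nucl j (nucl j a) ≈ nucl j a
    nucl-idem j a = le₁ , le₂
      where
      a≤na : a ≤ nucl j a
      a≤na = ⋀-glb proj₁ (λ p → proj₂ (proj₂ p))
      le₁ : nucl j (nucl j a) ≤ nucl j a
      le₁ = ⋀-glb proj₁ (λ { (x , fx , a≤x) →
              ⋀-lb proj₁ (x , fx , ⋀-lb proj₁ (x , fx , a≤x)) })
      le₂ : nucl j a ≤ nucl j (nucl j a)
      le₂ = ⋀-glb proj₁ (λ { (x , fx , na≤x) → na≤x })

  power : (A : Module) (T : Set ℓ) → RawModule
  power A T = record
    { M   = T → Module.M A
    ; _≤_ = λ x y → ∀ t → Module._≤_ A (x t) (y t)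
    ; ⋁   = λ x t → Module.⋁ A (λ i → x i t)
    ; _*_ = λ v x t → Module._*_ A v (x t)
    }

  power-cl : (A : Module) (T : Set ℓ) →
    IsCompleteLattice (RawModule.M (power A T)) (RawModule._≤_ (power A T)) (RawModule.⋁ (power A T))
  power-cl A T = record
    { ≤-refl  = λ t → ≤-refl
    ; ≤-trans = λ p q t → ≤-trans (p t) (q t)
    ; ⋁-ub    = λ x i t → ⋁-ub (λ k → x k t) i
    ; ⋁-least = λ x h t → ⋁-least (λ k → x k t) (λ i → h i t)
    }
    where open IsCompleteLattice (IsModule.isCompleteLattice (Module.isModule A))

  module Tensor (H : FSemilattice) where
    open FSemilattice H
    module A = Module A

    _ᵢᵣ : {J : Frame} → A.M → Frame.T J → Frame.T J → A.M
    _ᵢᵣ {J} x i j = Frame.r J i j A.* x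

    -- x_{i=}(i) = x and x_{i=}(j) = 0 for j ≠ i  (the join over the proof-set i ≡ j)
    _ᵢ₌ : {J : Frame} → A.M → Frame.T J → Frame.T J → A.M
    _ᵢ₌ {J} x i j = A.⋁ {I = i ≡ j} (λ _ → x)

    gens : (J : Frame) → A.M × Frame.T J →
           RawModule.M (power A (Frame.T J)) × RawModule.M (power A (Frame.T J))
    gens J (x , i) =
      ( Constructions._∨_ (power A (Frame.T J)) (_ᵢᵣ {J} x i) (_ᵢ₌ {J} (F x) i)
      , _ᵢ₌ {J} (F x) i )

    kJ : (J : Frame) → (Frame.T J → A.M) → (Frame.T J → A.M)
    kJ J = Constructions.nucl (power A (Frame.T J))
             (Constructions.jgen (power A (Frame.T J)) (gens J))

    kJ-idem : (J : Frame) (x : Frame.T J → A.M) →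
              RawModule._≈_ (power A (Frame.T J)) (kJ J (kJ J x)) (kJ J x)
    kJ-idem J = CLProps.nucl-idem (power A (Frame.T J)) (power-cl A (Frame.T J))
                  (Constructions.jgen (power A (Frame.T J)) (gens J))

    _⊗H : Frame → RawModule
    J ⊗H = record
      { M   = Σ (Frame.T J → A.M) (λ x → RawModule._≈_ (power A (Frame.T J)) (kJ J x) x)
      ; _≤_ = λ m n → RawModule._≤_ (power A (Frame.T J)) (proj₁ m) (proj₁ n)
      ; ⋁   = λ S → kJ J (RawModule.⋁ (power A (Frame.T J)) (λ i → proj₁ (S i)))
                  , kJ-idem J _
      ; _*_ = λ v m → kJ J (RawModule._*_ (power A (Frame.T J)) v (proj₁ m))
                  , kJ-idem J _
      }

    nmap : (J : Frame) → (Frame.T J → A.M) → RawModule.M (J ⊗H)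
    nmap J x = kJ J x , kJ-idem J x

    _→* : {J₁ J₂ : Frame} → FrameHom J₁ J₂ → (Frame.T J₁ → A.M) → (Frame.T J₂ → A.M)
    _→* {J₁} f x k = A.⋁ {I = Σ (Frame.T J₁) (λ i → FrameHom.fun f i ≡ k)} (λ p → x (proj₁ p))

-- Fixed points of a nucleus form a module as soon as the nucleus is lax
-- with respect to the action, v * k a ≤ k (v * a), and for kJ this holds because the
-- generating pairs (x_{ir} ∨ F(x)_{i=}, F(x)_{i=}) are carried into generating pairs by
-- the action of V. For a frame homomorphism f, the map f^→ preserves joins and the
-- action and is left adjoint to precomposition with f; since f does not decrease r,
-- precomposition preserves j-closed elements, so f^→ (kJ₁ x) ≤ kJ₂ (f^→ x). Hence
-- kJ₂ ∘ f^→ descends to a module homomorphism J₁ ⊗ H → J₂ ⊗ H, unique because every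
-- element of J₁ ⊗ H lies in the image of kJ₁; functoriality follows from
-- id^→ = id and (g ∘ f)^→ = g^→ ∘ f^→.
module Submission where

open import Data.Product using (Σ; _×_; _,_; proj₁; proj₂; swap)
open import Data.Sum using (inj₁; inj₂)
open import Data.Unit.Polymorphic using (tt)
open import Relation.Binary.Bundles using (Setoid)
open import Relation.Binary.PropositionalEquality using (refl)
import Relation.Binary.Reasoning.Setoid as SetoidReasoning

open import Defs

module _ {ℓ} (Q : Quantale ℓ) where
  open Quantale Q using (_⊗_; ⊗-comm)
  private module VL = IsCompleteLattice (Quantale.isCompleteLattice Q)

  module LatticeFacts (R : RawModule Q)
    (cl : IsCompleteLattice (RawModule.M R) (RawModule._≤_ R) (RawModule.⋁ R)) where
    open RawModule R
    open IsCompleteLattice cl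

    ≈-setoid : Setoid ℓ ℓ
    ≈-setoid = record
      { Carrier       = M
      ; _≈_           = _≈_
      ; isEquivalence = record
        { refl  = ≤-refl , ≤-refl
        ; sym   = swap
        ; trans = λ p q → ≤-trans (proj₁ p) (proj₁ q) , ≤-trans (proj₂ q) (proj₂ p)
        }
      }

    open Setoid ≈-setoid public using () renaming (sym to ≈-sym; trans to ≈-trans)
    module ≈-Reasoning = SetoidReasoning ≈-setoid

    ⋁-swap : ∀ {I J : Set ℓ} (x : I → J → M) →
             ⋁ (λ i → ⋁ (λ j → x i j)) ≈ ⋁ (λ j → ⋁ (λ i → x i j))
    ⋁-swap x = swap≤ x , swap≤ (λ j i → x i j)
      where
      swap≤ : ∀ {I J : Set ℓ} (y : I → J → M) →
              ⋁ (λ i → ⋁ (λ j → y i j)) ≤ ⋁ (λ j → ⋁ (λ i → y i j))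
      swap≤ y = ⋁-least _ λ i → ⋁-least _ λ j →
                  ≤-trans (⋁-ub (λ i′ → y i′ j) i) (⋁-ub _ j)

  modHom-monotone : {R S : RawModule Q} →
    IsCompleteLattice (RawModule.M R) (RawModule._≤_ R) (RawModule.⋁ R) →
    IsCompleteLattice (RawModule.M S) (RawModule._≤_ S) (RawModule.⋁ S) →
    {h : RawModule.M R → RawModule.M S} → IsModHom Q R S h →
    ∀ {a b} → RawModule._≤_ R a b → RawModule._≤_ S (h a) (h b)
  modHom-monotone {R} {S} clR clS h-hom {a} {b} a≤b =
    S.≤-trans (S.⋁-ub _ (inj₁ tt))
      (S.≤-trans (proj₂ (h-⋁ _)) (proj₁ (h-cong a∨b≈b)))
    where
    module R = IsCompleteLattice clR
    module S = IsCompleteLattice clS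
    open IsModHom h-hom
    open Constructions Q R using (_∨_)
    a∨b≈b : RawModule._≈_ R (a ∨ b) b
    a∨b≈b = R.⋁-least _ (λ { (inj₁ _) → a≤b ; (inj₂ _) → R.≤-refl }) , R.⋁-ub _ (inj₂ tt)

  *-exchange : {R : RawModule Q} → IsModule Q R →
    ∀ u v a → RawModule._≈_ R (RawModule._*_ R u (RawModule._*_ R v a))
                              (RawModule._*_ R v (RawModule._*_ R u a))
  *-exchange {R} R-mod u v a = begin
    u * (v * a)  ≈⟨ *-assoc u v a ⟩
    (u ⊗ v) * a  ≈⟨ *-mono (proj₁ (⊗-comm u v)) ≤-refl , *-mono (proj₂ (⊗-comm u v)) ≤-refl ⟩
    (v ⊗ u) * a  ≈⟨ ≈-sym (*-assoc v u a) ⟩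
    v * (u * a)  ∎
    where
    open RawModule R
    open IsModule R-mod
    open IsCompleteLattice isCompleteLattice
    open LatticeFacts R isCompleteLattice
    open ≈-Reasoning

  power-isModule : (B : Module Q) (T : Set ℓ) → IsModule Q (power Q B T)
  power-isModule B T = record
    { isCompleteLattice = power-cl Q B T
    ; *-mono      = λ u≤v a≤b t → *-mono u≤v (a≤b t)
    ; *-distrib-⋁ = λ v x → (λ t → proj₁ (*-distrib-⋁ v (λ i → x i t)))
                          , (λ t → proj₂ (*-distrib-⋁ v (λ i → x i t)))
    ; ⋁-distrib-* = λ u a → (λ t → proj₁ (⋁-distrib-* u (a t)))
                          , (λ t → proj₂ (⋁-distrib-* u (a t)))
    ; *-assoc     = λ u v a → (λ t → proj₁ (*-assoc u v (a t)))
                            , (λ t → proj₂ (*-assoc u v (a t)))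
    ; *-identity  = λ a → (λ t → proj₁ (*-identity (a t))) , (λ t → proj₂ (*-identity (a t)))
    }
    where open IsModule (Module.isModule B)

  record IsNucleus (R : RawModule Q) (k : RawModule.M R → RawModule.M R) : Set ℓ where
    open RawModule R
    field
      extensive  : ∀ {a} → a ≤ k a
      monotone   : ∀ {a b} → a ≤ b → k a ≤ k b
      idempotent : ∀ {a} → k (k a) ≤ k a
      *-lax      : ∀ v a → (v * k a) ≤ k (v * a)

  module NucleusFacts {R : RawModule Q} (R-mod : IsModule Q R)
    {k : RawModule.M R → RawModule.M R} (nucleus : IsNucleus R k) where
    open RawModule R
    open IsModule R-mod
    open IsCompleteLattice isCompleteLattice
    open IsNucleus nucleus

    k-cong : ∀ {a b} → a ≈ b → k a ≈ k b
    k-cong (a≤b , b≤a) = monotone a≤b , monotone b≤a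

    k-sandwich : ∀ {a b} → a ≤ b → b ≤ k a → k a ≈ k b
    k-sandwich a≤b b≤ka = monotone a≤b , ≤-trans (monotone b≤ka) idempotent

    k-least : ∀ {a b} → k b ≤ b → a ≤ b → k a ≤ b
    k-least kb≤b a≤b = ≤-trans (monotone a≤b) kb≤b

    k-⋁-absorb : ∀ {I : Set ℓ} (x : I → M) → k (⋁ x) ≈ k (⋁ (λ i → k (x i)))
    k-⋁-absorb x = k-sandwich (⋁-least _ λ i → ≤-trans extensive (⋁-ub _ i))
                              (⋁-least _ λ i → monotone (⋁-ub x i))

    k-*-absorb : ∀ v a → k (v * a) ≈ k (v * k a)
    k-*-absorb v a = k-sandwich (*-mono VL.≤-refl extensive) (*-lax v a)

  -- The idempotence proof is a parameter so that J ⊗H is definitionally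
  -- Fixed (power Q A T) (kJ J) (kJ-idem J).
  Fixed : (R : RawModule Q) (k : RawModule.M R → RawModule.M R) →
          (∀ a → RawModule._≈_ R (k (k a)) (k a)) → RawModule Q
  Fixed R k k-idem = record
    { M   = Σ M (λ a → k a ≈ a)
    ; _≤_ = λ m n → proj₁ m ≤ proj₁ n
    ; ⋁   = λ s → k (⋁ (λ i → proj₁ (s i))) , k-idem _
    ; _*_ = λ v m → k (v * proj₁ m) , k-idem _
    }
    where open RawModule R

  fixed-isModule : {R : RawModule Q} → IsModule Q R →
    {k : RawModule.M R → RawModule.M R} (k-idem : ∀ a → RawModule._≈_ R (k (k a)) (k a)) →
    IsNucleus R k → IsModule Q (Fixed R k k-idem)
  fixed-isModule {R} R-mod {k} k-idem nucleus = record
    { isCompleteLattice = record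
      { ≤-refl  = ≤-refl
      ; ≤-trans = ≤-trans
      ; ⋁-ub    = λ s i → ≤-trans (⋁-ub (λ i → proj₁ (s i)) i) extensive
      ; ⋁-least = λ s {b} s≤b → k-least (proj₁ (proj₂ b)) (⋁-least _ s≤b)
      }
    ; *-mono      = λ u≤v a≤b → monotone (*-mono u≤v a≤b)
    ; *-distrib-⋁ = λ v s → begin
        k (v * k (⋁ (λ i → proj₁ (s i))))  ≈⟨ ≈-sym (k-*-absorb v _) ⟩
        k (v * ⋁ (λ i → proj₁ (s i)))      ≈⟨ k-cong (*-distrib-⋁ v _) ⟩
        k (⋁ (λ i → v * proj₁ (s i)))      ≈⟨ k-⋁-absorb _ ⟩
        k (⋁ (λ i → k (v * proj₁ (s i))))  ∎
    ; ⋁-distrib-* = λ u m → ≈-trans (k-cong (⋁-distrib-* u (proj₁ m))) (k-⋁-absorb _)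
    ; *-assoc     = λ u v m → ≈-trans (≈-sym (k-*-absorb u _)) (k-cong (*-assoc u v (proj₁ m)))
    ; *-identity  = λ m → ≈-trans (k-cong (*-identity (proj₁ m))) (proj₂ m)
    }
    where
    open RawModule R
    open IsModule R-mod
    open IsCompleteLattice isCompleteLattice
    open LatticeFacts R isCompleteLattice
    open IsNucleus nucleus
    open NucleusFacts R-mod nucleus
    open ≈-Reasoning

  module Generated (R : RawModule Q)
    (cl : IsCompleteLattice (RawModule.M R) (RawModule._≤_ R) (RawModule.⋁ R))
    {K : Set ℓ} (X : K → RawModule.M R × RawModule.M R) where
    open RawModule R
    open IsCompleteLattice cl
    open Constructions Q R using (jgen; nucl)
    open CLProps Q R cl using (⋀-lb; ⋀-glb)

    lhs rhs : K → M
    lhs κ = proj₁ (X κ)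
    rhs κ = proj₂ (X κ)

    j : M → M
    j = jgen X

    j-extensive : ∀ {a} → a ≤ j a
    j-extensive = ⋁-ub _ (inj₁ tt)

    j-lhs : ∀ {a} κ → rhs κ ≤ a → lhs κ ≤ j a
    j-lhs κ p = ⋁-ub _ (inj₂ (inj₁ (κ , p)))

    j-rhs : ∀ {a} κ → lhs κ ≤ a → rhs κ ≤ j a
    j-rhs κ p = ⋁-ub _ (inj₂ (inj₂ (κ , p)))

    j-least : ∀ {a b} → a ≤ b →
              (∀ κ → rhs κ ≤ a → lhs κ ≤ b) → (∀ κ → lhs κ ≤ a → rhs κ ≤ b) → j a ≤ b
    j-least a≤b lhs≤b rhs≤b = ⋁-least _ λ
      { (inj₁ _)               → a≤b
      ; (inj₂ (inj₁ (κ , p))) → lhs≤b κ p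
      ; (inj₂ (inj₂ (κ , p))) → rhs≤b κ p
      }

    j-monotone : ∀ {a b} → a ≤ b → j a ≤ j b
    j-monotone a≤b = j-least (≤-trans a≤b j-extensive)
                             (λ κ p → j-lhs κ (≤-trans p a≤b))
                             (λ κ p → j-rhs κ (≤-trans p a≤b))

    k : M → M
    k = nucl j

    k-extensive : ∀ {a} → a ≤ k a
    k-extensive = ⋀-glb proj₁ (λ p → proj₂ (proj₂ p))

    k-least : ∀ {a b} → j b ≤ b → a ≤ b → k a ≤ b
    k-least {a} {b} jb≤b a≤b = ⋀-lb proj₁ (b , (jb≤b , j-extensive) , a≤b)

    k-monotone : ∀ {a b} → a ≤ b → k a ≤ k b
    k-monotone a≤b = ⋀-glb proj₁ λ { (x , jx≈x , b≤x) → ⋀-lb proj₁ (x , jx≈x , ≤-trans a≤b b≤x) }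

    k-closed : ∀ a → j (k a) ≤ k a
    k-closed a = ⋀-glb proj₁ λ { (x , jx≈x , a≤x) →
                   ≤-trans (j-monotone (⋀-lb proj₁ (x , jx≈x , a≤x))) (proj₁ jx≈x) }

    k-idempotent : ∀ {a} → k (k a) ≤ k a
    k-idempotent = k-least (k-closed _) ≤-refl

    k-isNucleus : IsModule Q R → (∀ κ → rhs κ ≤ lhs κ) →
      (∀ v κ → Σ K λ κ′ → ((v * lhs κ) ≤ lhs κ′) × (rhs κ′ ≤ (v * rhs κ))) →
      IsNucleus R k
    k-isNucleus R-mod rhs≤lhs *-stable = record
      { extensive  = k-extensive
      ; monotone   = k-monotone
      ; idempotent = k-idempotent
      ; *-lax      = *-lax
      }
      where
      open IsModule R-mod using (*-mono; *-distrib-⋁)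

      *-monoʳ : ∀ {v a b} → a ≤ b → (v * a) ≤ (v * b)
      *-monoʳ = *-mono VL.≤-refl

      -- k y lies below the residual z = ⋁ { u | v * u ≤ k (v * y) }, which is j-closed.
      *-lax : ∀ v y → (v * k y) ≤ k (v * y)
      *-lax v y = ≤-trans (*-monoʳ ky≤z) vz≤w
        where
        w : M
        w = k (v * y)
        z : M
        z = ⋁ {I = Σ M λ u → (v * u) ≤ w} proj₁
        vz≤w : (v * z) ≤ w
        vz≤w = ≤-trans (proj₁ (*-distrib-⋁ v _)) (⋁-least _ proj₂)
        ≤z : ∀ {u} → (v * u) ≤ w → u ≤ z
        ≤z p = ⋁-ub proj₁ (_ , p)
        vlhs≤w : ∀ κ → rhs κ ≤ z → (v * lhs κ) ≤ w
        vlhs≤w κ rhsκ≤z with *-stable v κ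
        ... | κ′ , vlhs≤lhs′ , rhs′≤vrhs =
          ≤-trans vlhs≤lhs′ (≤-trans (j-lhs κ′ (≤-trans rhs′≤vrhs (≤-trans (*-monoʳ rhsκ≤z) vz≤w)))
                                     (k-closed _))
        z-closed : j z ≤ z
        z-closed = j-least ≤-refl (λ κ p → ≤z (vlhs≤w κ p)) (λ κ p → ≤-trans (rhs≤lhs κ) p)
        ky≤z : k y ≤ z
        ky≤z = k-least z-closed (≤z k-extensive)

  module Induced {R S : RawModule Q} (R-mod : IsModule Q R) (S-mod : IsModule Q S)
    {k₁ : RawModule.M R → RawModule.M R} {k₂ : RawModule.M S → RawModule.M S}
    (k₁-idem : ∀ a → RawModule._≈_ R (k₁ (k₁ a)) (k₁ a))
    (k₂-idem : ∀ a → RawModule._≈_ S (k₂ (k₂ a)) (k₂ a))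
    (nucleus₁ : IsNucleus R k₁) (nucleus₂ : IsNucleus S k₂)
    {φ : RawModule.M R → RawModule.M S} (φ-hom : IsModHom Q R S φ)
    (φ-closure : ∀ a → RawModule._≤_ S (φ (k₁ a)) (k₂ (φ a))) where
    private
      module R/k₁ = RawModule (Fixed R k₁ k₁-idem)
      module S/k₂ = RawModule (Fixed S k₂ k₂-idem)
      module SL = LatticeFacts S (IsModule.isCompleteLattice S-mod)
      open IsModHom φ-hom using (h-cong; h-⋁; h-*)
      open NucleusFacts S-mod nucleus₂

    induced : R/k₁.M → S/k₂.M
    induced m = k₂ (φ (proj₁ m)) , k₂-idem _

    induced-square : ∀ a → (k₂ (φ a) , k₂-idem _) S/k₂.≈ induced (k₁ a , k₁-idem a)
    induced-square a =
      k-sandwich (modHom-monotone (IsModule.isCompleteLattice R-mod)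
                                  (IsModule.isCompleteLattice S-mod)
                                  φ-hom (IsNucleus.extensive nucleus₁))
                 (φ-closure a)

    induced-isModHom : IsModHom Q (Fixed R k₁ k₁-idem) (Fixed S k₂ k₂-idem) induced
    induced-isModHom = record
      { h-cong = λ a≈b → k-cong (h-cong a≈b)
      ; h-⋁    = λ s → SL.≈-trans (SL.≈-sym (induced-square _))
                         (SL.≈-trans (k-cong (h-⋁ _)) (k-⋁-absorb _))
      ; h-*    = λ v m → SL.≈-trans (SL.≈-sym (induced-square _))
                           (SL.≈-trans (k-cong (h-* v _)) (k-*-absorb v _))
      }

    induced-unique : (g : R/k₁.M → S/k₂.M) →
      IsModHom Q (Fixed R k₁ k₁-idem) (Fixed S k₂ k₂-idem) g →
      (∀ a → (k₂ (φ a) , k₂-idem _) S/k₂.≈ g (k₁ a , k₁-idem a)) →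
      ∀ m → g m S/k₂.≈ induced m
    induced-unique g g-hom g-square m =
      SL.≈-trans (IsModHom.h-cong g-hom (swap (proj₂ m))) (SL.≈-sym (g-square (proj₁ m)))

module TensorFunctor {ℓ} (Q : Quantale ℓ) (H : FSemilattice Q) where
  open Tensor Q H
  open FSemilattice H using (F-hom)
  open IsModule (Module.isModule (FSemilattice.A H))
  open IsCompleteLattice isCompleteLattice
  open LatticeFacts Q (Module.raw (FSemilattice.A H)) isCompleteLattice
  private module VL = IsCompleteLattice (Quantale.isCompleteLattice Q)

  Aᵀ : Set ℓ → RawModule Q
  Aᵀ = power Q (FSemilattice.A H)

  Aᵀ-isModule : (T : Set ℓ) → IsModule Q (Aᵀ T)
  Aᵀ-isModule = power-isModule Q (FSemilattice.A H)

  module Gen (J : Frame Q) =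
    Generated Q (Aᵀ (Frame.T J)) (power-cl Q (FSemilattice.A H) (Frame.T J)) (gens J)

  module _ (J : Frame Q) where
    open Frame J
    open Gen J using (lhs; rhs)

    gens-rhs≤lhs : ∀ κ t → A._≤_ (rhs κ t) (lhs κ t)
    gens-rhs≤lhs κ t = ⋁-ub _ (inj₂ tt)

    gens-*-stable : ∀ v κ → Σ (A.M × T) λ κ′ →
      (∀ t → A._≤_ (v A.* lhs κ t) (lhs κ′ t)) × (∀ t → A._≤_ (rhs κ′ t) (v A.* rhs κ t))
    gens-*-stable v (x , i) = (v A.* x , i) , vlhs≤lhs′ , rhs′≤vrhs
      where
      open IsModHom F-hom using (h-*)
      vlhs≤lhs′ : ∀ t → A._≤_ (v A.* lhs (x , i) t) (lhs (v A.* x , i) t)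
      vlhs≤lhs′ t = ≤-trans (proj₁ (*-distrib-⋁ v _)) (⋁-least _ λ
        { (inj₁ _) → ≤-trans (proj₁ (*-exchange Q (Module.isModule (FSemilattice.A H)) v (r i t) x))
                             (⋁-ub _ (inj₁ tt))
        ; (inj₂ _) → ≤-trans (proj₁ (*-distrib-⋁ v _))
                       (≤-trans (⋁-least _ λ p → ≤-trans (proj₂ (h-* v x)) (⋁-ub _ p))
                                (⋁-ub _ (inj₂ tt)))
        })
      rhs′≤vrhs : ∀ t → A._≤_ (rhs (v A.* x , i) t) (v A.* rhs (x , i) t)
      rhs′≤vrhs t = ⋁-least _ λ p → ≤-trans (proj₁ (h-* v x)) (*-mono VL.≤-refl (⋁-ub _ p))

    kJ-isNucleus : IsNucleus Q (Aᵀ T) (kJ J)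
    kJ-isNucleus = Gen.k-isNucleus J (Aᵀ-isModule T) gens-rhs≤lhs gens-*-stable

    ⊗H-isModule : IsModule Q (J ⊗H)
    ⊗H-isModule = fixed-isModule Q (Aᵀ-isModule T) (kJ-idem J) kJ-isNucleus

  module _ {J₁ J₂ : Frame Q} (f : FrameHom Q J₁ J₂) where
    private
      module G₁ = Gen J₁
      module G₂ = Gen J₂
      T₁ T₂ : Set ℓ
      T₁ = Frame.T J₁
      T₂ = Frame.T J₂
      fun : T₁ → T₂
      fun = FrameHom.fun f
      f→ : (T₁ → A.M) → T₂ → A.M
      f→ = _→* {J₁} {J₂} f

    →*-unit : ∀ (x : T₁ → A.M) t → A._≤_ (x t) (f→ x (fun t))
    →*-unit x t = ⋁-ub _ (t , refl)

    →*-least : ∀ {x : T₁ → A.M} {y : T₂ → A.M} →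
               (∀ t → A._≤_ (x t) (y (fun t))) → ∀ s → A._≤_ (f→ x s) (y s)
    →*-least x≤y∘fun s = ⋁-least _ λ { (t , refl) → x≤y∘fun t }

    →*-isModHom : IsModHom Q (Aᵀ T₁) (Aᵀ T₂) f→
    →*-isModHom = record
      { h-cong = λ (x≤y , y≤x) → →*-monotone x≤y , →*-monotone y≤x
      ; h-⋁    = λ x → (λ s → proj₁ (⋁-swap _)) , (λ s → proj₂ (⋁-swap _))
      ; h-*    = λ v x → (λ s → proj₂ (*-distrib-⋁ v _)) , (λ s → proj₁ (*-distrib-⋁ v _))
      }
      where
      →*-monotone : ∀ {x y : T₁ → A.M} → (∀ t → A._≤_ (x t) (y t)) → ∀ s → A._≤_ (f→ x s) (f→ y s)
      →*-monotone x≤y = →*-least λ t → ≤-trans (x≤y t) (→*-unit _ t)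

    precompose-closed : ∀ {y : T₂ → A.M} → RawModule._≤_ (Aᵀ T₂) (G₂.j y) y →
                        RawModule._≤_ (Aᵀ T₁) (G₁.j (λ t → y (fun t))) (λ t → y (fun t))
    precompose-closed {y} jy≤y =
      G₁.j-least (λ t → ≤-refl) lhs≤ (λ κ lhs≤y t → ≤-trans (gens-rhs≤lhs J₁ κ t) (lhs≤y t))
      where
      lhs≤ : ∀ κ → (∀ t → A._≤_ (G₁.rhs κ t) (y (fun t))) → ∀ t → A._≤_ (G₁.lhs κ t) (y (fun t))
      lhs≤ (x , i) rhs≤y t = ⋁-least _ λ
        { (inj₁ _) → ≤-trans (*-mono (FrameHom.mono f i t) ≤-refl)
                       (≤-trans (⋁-ub _ (inj₁ tt)) (≤-trans (G₂.j-lhs (x , fun i) rhs₂≤y (fun t))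
                                                              (jy≤y (fun t))))
        ; (inj₂ _) → rhs≤y t
        }
        where
        rhs₂≤y : ∀ s → A._≤_ (G₂.rhs (x , fun i) s) (y s)
        rhs₂≤y s = ⋁-least _ λ { refl → ≤-trans (⋁-ub _ refl) (rhs≤y i) }

    →*-kJ : ∀ x s → A._≤_ (f→ (kJ J₁ x) s) (kJ J₂ (f→ x) s)
    →*-kJ x = →*-least (G₁.k-least (precompose-closed (G₂.k-closed _))
                                   (λ t → ≤-trans (→*-unit x t) (G₂.k-extensive (fun t))))

    open Induced Q (Aᵀ-isModule T₁) (Aᵀ-isModule T₂) (kJ-idem J₁) (kJ-idem J₂)
                   (kJ-isNucleus J₁) (kJ-isNucleus J₂) →*-isModHom →*-kJ public
      renaming ( induced to map⊗H ; induced-square to map⊗H-square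
               ; induced-isModHom to map⊗H-isModHom ; induced-unique to map⊗H-unique )

  map⊗H-identity : (J : Frame Q) (y : RawModule.M (J ⊗H)) →
                   RawModule._≈_ (J ⊗H) (map⊗H (idFrameHom Q J) y) y
  map⊗H-identity J y = ≈ᵀ-trans (k-cong (id→*≤ , →*-unit (idFrameHom Q J) (proj₁ y))) (proj₂ y)
    where
    open NucleusFacts Q (Aᵀ-isModule (Frame.T J)) (kJ-isNucleus J) using (k-cong)
    open LatticeFacts Q (Aᵀ (Frame.T J)) (power-cl Q (FSemilattice.A H) (Frame.T J))
      using () renaming (≈-trans to ≈ᵀ-trans)
    id→*≤ : ∀ t → A._≤_ (_→* {J} {J} (idFrameHom Q J) (proj₁ y) t) (proj₁ y t)
    id→*≤ = →*-least (idFrameHom Q J) (λ t → ≤-refl)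

  map⊗H-∘ : (J₁ J₂ J₃ : Frame Q) (f : FrameHom Q J₁ J₂) (g : FrameHom Q J₂ J₃)
            (y : RawModule.M (J₁ ⊗H)) →
            RawModule._≈_ (J₃ ⊗H) (map⊗H (_∘F_ Q {J₁} {J₂} {J₃} g f) y) (map⊗H g (map⊗H f y))
  map⊗H-∘ J₁ J₂ J₃ f g y = ≈ᵀ-trans (k-cong (gf→≤ , ≤gf→)) (map⊗H-square g (f→ (proj₁ y)))
    where
    open NucleusFacts Q (Aᵀ-isModule (Frame.T J₃)) (kJ-isNucleus J₃) using (k-cong)
    open LatticeFacts Q (Aᵀ (Frame.T J₃)) (power-cl Q (FSemilattice.A H) (Frame.T J₃))
      using () renaming (≈-trans to ≈ᵀ-trans)
    gf : FrameHom Q J₁ J₃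
    gf = _∘F_ Q {J₁} {J₂} {J₃} g f
    f→ : (Frame.T J₁ → A.M) → Frame.T J₂ → A.M
    f→ = _→* {J₁} {J₂} f
    g→ : (Frame.T J₂ → A.M) → Frame.T J₃ → A.M
    g→ = _→* {J₂} {J₃} g
    gf→≤ : ∀ s → A._≤_ (_→* {J₁} {J₃} gf (proj₁ y) s) (g→ (f→ (proj₁ y)) s)
    gf→≤ = →*-least gf λ t →
             ≤-trans (→*-unit f (proj₁ y) t) (→*-unit g (f→ (proj₁ y)) (FrameHom.fun f t))
    ≤gf→ : ∀ s → A._≤_ (g→ (f→ (proj₁ y)) s) (_→* {J₁} {J₃} gf (proj₁ y) s)
    ≤gf→ = →*-least g (→*-least f (→*-unit gf (proj₁ y)))

mainTheorem7 : ∀ {ℓ} (Q : Quantale ℓ) (H : FSemilattice Q) →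
    let open Tensor Q H in
    Σ ({J₁ J₂ : Frame Q} → FrameHom Q J₁ J₂ → RawModule.M (J₁ ⊗H) → RawModule.M (J₂ ⊗H))
      (λ fH →
        ((J : Frame Q) → IsModule Q (J ⊗H))
        × ((J₁ J₂ : Frame Q) (f : FrameHom Q J₁ J₂) →
             IsModHom Q (J₁ ⊗H) (J₂ ⊗H) (fH f)
           × ((x : Frame.T J₁ → A.M) →
                RawModule._≈_ (J₂ ⊗H) (nmap J₂ (_→* {J₁} {J₂} f x)) (fH f (nmap J₁ x)))
           × ((g : RawModule.M (J₁ ⊗H) → RawModule.M (J₂ ⊗H)) →
                IsModHom Q (J₁ ⊗H) (J₂ ⊗H) g →
                ((x : Frame.T J₁ → A.M) →
                   RawModule._≈_ (J₂ ⊗H) (nmap J₂ (_→* {J₁} {J₂} f x)) (g (nmap J₁ x))) →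
                (y : RawModule.M (J₁ ⊗H)) → RawModule._≈_ (J₂ ⊗H) (g y) (fH f y)))
        × ((J : Frame Q) (y : RawModule.M (J ⊗H)) →
             RawModule._≈_ (J ⊗H) (fH (idFrameHom Q J) y) y)
        × ((J₁ J₂ J₃ : Frame Q) (f : FrameHom Q J₁ J₂) (g : FrameHom Q J₂ J₃)
           (y : RawModule.M (J₁ ⊗H)) →
             RawModule._≈_ (J₃ ⊗H) (fH (_∘F_ Q {J₁} {J₂} {J₃} g f) y) (fH g (fH f y))))
mainTheorem7 Q H =
    map⊗H
  , ⊗H-isModule
  , (λ J₁ J₂ f → map⊗H-isModHom f , map⊗H-square f , map⊗H-unique f)
  , map⊗H-identity
  , map⊗H-∘
  where open TensorFunctor Q H
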